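{- Let $G(V,E)$ be a connected graph. The output of Heuristic CDOM (described below) on $G$ is a connected dominating set of $G$. Heuristic CDOM: (1) Pick an arbitrary vertex $v\in V$. (2) Construct a breadth-first spanning tree $T$ of $G$ rooted at $v$, let $k$ be its depth, and let $S_i$ be the set of vertices at level $i$ of $T$ (distance $i$ from $v$), $0\le i\le k$. (3) Set $IS_0=\{v\}$, $NS_0=\emptyset$. (4) For $i=1,\dots,k$: let $DS_i$ be the set of vertices in $S_i$ adjacent to some vertex of $IS_{i-1}$; pick a maximal independent set $IS_i$ in the induced subgraph $G(S_i\setminus DS_i)$; let $NS_i$ be the set of parents in $T$ of the vertices of $IS_i$. (5) Output $\left(\bigcup_{i=0}^k IS_i\right)\cup\left(\bigcup_{i=0}^k NS_i\right)$.
   Context: A dominating set of $G$ is a set $V'$ of vertices such that every vertex not in $V'$ has a neighbor in $V'$; it is a connected dominating set if the subgraph induced on $V'$ is connected. -}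

module Defs where

open import Data.Nat using (ℕ; zero; suc; _≤_; _+_; _∸_)
open import Data.Fin using (Fin)
open import Data.Fin.Subset using (Subset; _∈_; _∉_; _∪_; ⁅_⁆)
open import Data.Product using (Σ; ∃; _×_; ∃-syntax)
open import Data.Sum using (_⊎_)
open import Data.Empty using (⊥)
open import Relation.Nullary using (¬_)
open import Relation.Binary using (Decidable)
open import Relation.Binary.PropositionalEquality using (_≡_; _≢_)

record Graph (n : ℕ) : Set₁ where
  field
    Adj   : Fin n → Fin n → Set
    adj?  : Decidable Adj
    sym   : ∀ {x y} → Adj x y → Adj y x
    irrefl : ∀ {x} → ¬ Adj x x

module _ {n : ℕ} (G : Graph n) where
  open Graph G

  data Walk : Fin n → Fin n → ℕ → Set where
    here : ∀ {u} → Walk u u 0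
    step : ∀ {u w x d} → Adj u w → Walk w x d → Walk u x (suc d)

  data WalkIn (D : Fin n → Set) : Fin n → Fin n → Set where
    here : ∀ {u} → D u → WalkIn D u u
    step : ∀ {u w x} → D u → Adj u w → WalkIn D w x → WalkIn D u x

  Connected : Set
  Connected = ∀ u w → ∃[ d ] Walk u w d

  Dist : Fin n → Fin n → ℕ → Set
  Dist u w d = Walk u w d × (∀ m → Walk u w m → d ≤ m)

  Dominating : (Fin n → Set) → Set
  Dominating D = ∀ u → ¬ D u → ∃[ w ] (D w × Adj u w)

  InducedConnected : (Fin n → Set) → Set
  InducedConnected D = ∀ u w → D u → D w → WalkIn D u w

  ConnectedDominatingSet : (Fin n → Set) → Set
  ConnectedDominatingSet D = Dominating D × InducedConnected D

  Independent : Subset n → Set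
  Independent I = ∀ x y → x ∈ I → y ∈ I → ¬ Adj x y

  MaximalIndependentIn : (Fin n → Set) → Subset n → Set
  MaximalIndependentIn X I =
    (∀ x → x ∈ I → X x) × Independent I ×
    (∀ x → X x → x ∉ I → ¬ Independent (I ∪ ⁅ x ⁆))

  record BFSTree (v : Fin n) : Set where
    field
      level     : Fin n → ℕ
      level-dist : ∀ u → Dist v u (level u)
      parent    : (u : Fin n) → u ≢ v → Fin n
      parent-adj : ∀ u (p : u ≢ v) → Adj (parent u p) u
      parent-level : ∀ u (p : u ≢ v) → suc (level (parent u p)) ≡ level u

  Depth : ∀ {v} → BFSTree v → ℕ → Set
  Depth T k = (∀ u → BFSTree.level T u ≤ k) × ∃[ u ] (BFSTree.level T u ≡ k)

  module CDOM {v : Fin n} (T : BFSTree v) (IS : ℕ → Subset n) where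
    open BFSTree T

    S : ℕ → Fin n → Set
    S i u = level u ≡ i

    DS : ℕ → Fin n → Set
    DS i u = S i u × ∃[ w ] (w ∈ IS (i ∸ 1) × Adj u w)

    Rest : ℕ → Fin n → Set
    Rest i u = S i u × ¬ DS i u

    NS : ℕ → Fin n → Set
    NS zero x = ⊥
    NS (suc i) x = ∃[ u ] Σ (u ∈ IS (suc i)) λ _ → Σ (u ≢ v) λ p → parent u p ≡ x

    -- the specification of the choices made in steps (3)-(4)
    ValidRun : ℕ → Set
    ValidRun k = (IS 0 ≡ ⁅ v ⁆) ×
      (∀ i → 1 ≤ i → i ≤ k → MaximalIndependentIn (Rest i) (IS i))

    Output : ℕ → Fin n → Set
    Output k x = ∃[ i ] (i ≤ k × (x ∈ IS i ⊎ NS i x))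

module Submission where

open import Defs
open import Data.Nat using (ℕ; zero; suc; _≤_; _∸_; z≤n; s≤s)
open import Data.Nat.Properties using (n≤0⇒n≡0; ≤-trans; m∸n≤m; n≤1+n; suc-injective)
open import Data.Fin using (Fin)
open import Data.Fin.Subset using (Subset; _∈_; _∉_; _∪_; ⁅_⁆)
open import Data.Fin.Subset.Properties using (_∈?_; x∈⁅x⁆; x∈⁅y⁆⇒x≡y; x∈p∪q⁻)
open import Data.Fin.Properties using (any?)
open import Data.Product using (_×_; _,_; proj₁; proj₂; ∃-syntax)
open import Data.Sum using (_⊎_; inj₁; inj₂)
open import Relation.Nullary using (¬_; Dec; yes; no; contradiction)
open import Relation.Nullary.Decidable using (_×-dec_; decidable-stable)
open import Relation.Binary.PropositionalEquality using (_≡_; _≢_; refl; sym; trans; subst)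

-- A vertex of level j is either in IS_j, adjacent to
-- IS_j (by maximality of IS_j), or adjacent to IS_{j-1} (it lies in DS_j);
-- this gives domination.  For connectivity, every vertex of IS_{j+1} is
-- adjacent to its parent, which is in the output and is itself dominated
-- by IS_j or IS_{j-1}; by induction on j every output vertex is joined to
-- v inside the output, and v serves as a hub.

module _ {n : ℕ} (G : Graph n) where
  open Graph G renaming (sym to Adj-sym)

  AdjacentTo : Subset n → Fin n → Set
  AdjacentTo I x = ∃[ w ] (w ∈ I × Adj x w)

  adjacentTo? : ∀ I x → Dec (AdjacentTo I x)
  adjacentTo? I x = any? (λ w → (w ∈? I) ×-dec adj? x w)

  Independent-∪-⁅⁆ : ∀ {I x} → Independent G I → ¬ AdjacentTo I x →
                     Independent G (I ∪ ⁅ x ⁆)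
  Independent-∪-⁅⁆ {I} {x} indI x↮I a b a∈ b∈ a~b
    with x∈p∪q⁻ I ⁅ x ⁆ a∈ | x∈p∪q⁻ I ⁅ x ⁆ b∈
  ... | inj₁ a∈I | inj₁ b∈I = indI a b a∈I b∈I a~b
  ... | inj₁ a∈I | inj₂ b∈x with x∈⁅y⁆⇒x≡y x b∈x
  ...   | refl = x↮I (a , a∈I , Adj-sym a~b)
  Independent-∪-⁅⁆ {I} {x} indI x↮I a b a∈ b∈ a~b | inj₂ a∈x | inj₁ b∈I
    with x∈⁅y⁆⇒x≡y x a∈x
  ...   | refl = x↮I (b , b∈I , a~b)
  Independent-∪-⁅⁆ {I} {x} indI x↮I a b a∈ b∈ a~b | inj₂ a∈x | inj₂ b∈x
    with x∈⁅y⁆⇒x≡y x a∈x | x∈⁅y⁆⇒x≡y x b∈x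
  ...   | refl | refl = irrefl a~b

  -- Maximality only refutes non-adjacency; decidability recovers the witness.
  maximalIndependent⇒adjacent : ∀ {X I x} → MaximalIndependentIn G X I →
                                X x → x ∉ I → AdjacentTo I x
  maximalIndependent⇒adjacent {I = I} {x} (_ , indI , maximal) x∈X x∉I =
    decidable-stable (adjacentTo? I x)
      (λ x↮I → maximal x x∈X x∉I (Independent-∪-⁅⁆ indI x↮I))

  module _ {D : Fin n → Set} where

    WalkIn-source : ∀ {u w} → WalkIn G D u w → D u
    WalkIn-source (here du)     = du
    WalkIn-source (step du _ _) = du

    WalkIn-++ : ∀ {u w x} → WalkIn G D u w → WalkIn G D w x → WalkIn G D u x
    WalkIn-++ (here _)       q = q
    WalkIn-++ (step du a p)  q = step du a (WalkIn-++ p q)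

    WalkIn-reverse : ∀ {u w} → WalkIn G D u w → WalkIn G D w u
    WalkIn-reverse p = go p (here (WalkIn-source p))
      where
        go : ∀ {u w x} → WalkIn G D u w → WalkIn G D u x → WalkIn G D w x
        go (here _)      acc = acc
        go (step _ a p)  acc = go p (step (WalkIn-source p) (Adj-sym a) acc)

    hub⇒InducedConnected : ∀ {h} → (∀ u → D u → WalkIn G D u h) →
                           InducedConnected G D
    hub⇒InducedConnected toHub u w du dw =
      WalkIn-++ (toHub u du) (WalkIn-reverse (toHub w dw))

module _ {n : ℕ} {G : Graph n} {v : Fin n} (T : BFSTree G v) where
  open BFSTree T

  level-root : level v ≡ 0
  level-root = n≤0⇒n≡0 (proj₂ (level-dist v) 0 here)

  level≡0⇒root : ∀ {u} → level u ≡ 0 → u ≡ v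
  level≡0⇒root {u} lu≡0 with subst (Walk G v u) lu≡0 (proj₁ (level-dist u))
  ... | here = refl

  level≡suc⇒≢root : ∀ {u j} → level u ≡ suc j → u ≢ v
  level≡suc⇒≢root lu≡1+j refl with trans (sym lu≡1+j) level-root
  ... | ()

  level-parent : ∀ {u j} (u≢v : u ≢ v) → level u ≡ suc j → level (parent u u≢v) ≡ j
  level-parent u≢v lu≡1+j = suc-injective (trans (parent-level _ u≢v) lu≡1+j)

module CDOMCorrect {n : ℕ} {G : Graph n} {v : Fin n} (T : BFSTree G v) (k : ℕ)
                   (IS : ℕ → Subset n) (valid : CDOM.ValidRun G T IS k) where
  open Graph G renaming (sym to Adj-sym)
  open BFSTree T
  open CDOM G T IS

  IS₀≡⁅v⁆ : IS 0 ≡ ⁅ v ⁆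
  IS₀≡⁅v⁆ = proj₁ valid

  IS-maximal : ∀ {j} → suc j ≤ k → MaximalIndependentIn G (Rest (suc j)) (IS (suc j))
  IS-maximal le = proj₂ valid _ (s≤s z≤n) le

  IS⊆Output : ∀ {i x} → i ≤ k → x ∈ IS i → Output k x
  IS⊆Output {i} le x∈ = i , le , inj₁ x∈

  v∈Output : Output k v
  v∈Output = IS⊆Output z≤n (subst (v ∈_) (sym IS₀≡⁅v⁆) (x∈⁅x⁆ v))

  covered : ∀ {j y} → j ≤ k → level y ≡ j →
            y ∈ IS j ⊎ AdjacentTo G (IS j) y ⊎ AdjacentTo G (IS (j ∸ 1)) y
  covered {zero} _ ly≡0 with level≡0⇒root T ly≡0
  ... | refl = inj₁ (subst (v ∈_) (sym IS₀≡⁅v⁆) (x∈⁅x⁆ v))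
  covered {suc j} {y} le ly with adjacentTo? G (IS j) y
  ... | yes y~IS = inj₂ (inj₂ y~IS)
  ... | no  y↮IS with y ∈? IS (suc j)
  ...   | yes y∈IS = inj₁ y∈IS
  ...   | no  y∉IS = inj₂ (inj₁ (maximalIndependent⇒adjacent G (IS-maximal le)
                                   (ly , λ y∈DS → y↮IS (proj₂ y∈DS)) y∉IS))

  ReachesRoot : Fin n → Set
  ReachesRoot x = WalkIn G (Output k) x v

  AllReachRoot : ℕ → Set
  AllReachRoot i = ∀ x → x ∈ IS i → ReachesRoot x

  covered⇒reachesRoot : ∀ {j y} → j ≤ k → level y ≡ j → Output k y →
                        AllReachRoot j → AllReachRoot (j ∸ 1) → ReachesRoot y
  covered⇒reachesRoot le ly y∈O reach reach′ with covered le ly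
  ... | inj₁ y∈IS               = reach _ y∈IS
  ... | inj₂ (inj₁ (w , w∈ , a)) = step y∈O a (reach w w∈)
  ... | inj₂ (inj₂ (w , w∈ , a)) = step y∈O a (reach′ w w∈)

  parent∈Output : ∀ {i u} → suc i ≤ k → u ∈ IS (suc i) → (u≢v : u ≢ v) →
                  Output k (parent u u≢v)
  parent∈Output {i} {u} le u∈ u≢v = suc i , le , inj₂ (u , u∈ , u≢v , refl)

  allReachRoot-suc : ∀ {j} → suc j ≤ k → AllReachRoot j → AllReachRoot (j ∸ 1) →
                     AllReachRoot (suc j)
  allReachRoot-suc le reach reach′ x x∈ =
    step (IS⊆Output le x∈) (Adj-sym (parent-adj x x≢v))
      (covered⇒reachesRoot (≤-trans (n≤1+n _) le) (level-parent T x≢v lx)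
        (parent∈Output le x∈ x≢v) reach reach′)
    where
      lx = proj₁ (proj₁ (IS-maximal le) x x∈)
      x≢v = level≡suc⇒≢root T lx

  -- The pair is the induction hypothesis: level j + 1 draws on levels j and j - 1.
  allReachRoot : ∀ j → j ≤ k → AllReachRoot j × AllReachRoot (j ∸ 1)
  allReachRoot zero _ = reach₀ , reach₀
    where
      reach₀ : AllReachRoot 0
      reach₀ x x∈ with x∈⁅y⁆⇒x≡y v (subst (x ∈_) IS₀≡⁅v⁆ x∈)
      ... | refl = here v∈Output
  allReachRoot (suc j) le =
    let reach , reach′ = allReachRoot j (≤-trans (n≤1+n j) le)
    in allReachRoot-suc le reach reach′ , reach

  output-reachesRoot : ∀ x → Output k x → ReachesRoot x
  output-reachesRoot x (i , le , inj₁ x∈) = proj₁ (allReachRoot i le) x x∈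
  output-reachesRoot x x∈O@(suc i , le , inj₂ (u , u∈ , u≢v , refl)) =
    step x∈O (parent-adj u u≢v) (proj₁ (allReachRoot (suc i) le) u u∈)

  dominating : (∀ u → level u ≤ k) → Dominating G (Output k)
  dominating bounded u u∉O with covered (bounded u) refl
  ... | inj₁ u∈IS               = contradiction (IS⊆Output (bounded u) u∈IS) u∉O
  ... | inj₂ (inj₁ (w , w∈ , a)) = w , IS⊆Output (bounded u) w∈ , a
  ... | inj₂ (inj₂ (w , w∈ , a)) =
    w , IS⊆Output (≤-trans (m∸n≤m (level u) 1) (bounded u)) w∈ , a

lemma4p4 : ∀ {n} (G : Graph n) → Connected G →
    (v : Fin n) (T : BFSTree G v) (k : ℕ) → Depth G T k →
    (IS : ℕ → Subset n) → CDOM.ValidRun G T IS k →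
    ConnectedDominatingSet G (CDOM.Output G T IS k)
lemma4p4 G _ v T k (bounded , _) IS valid =
  dominating bounded , hub⇒InducedConnected G output-reachesRoot
  where open CDOMCorrect T k IS valid
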